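{- Let $\mathcal{F}$ be a hereditary family of hypergraphs and $k\ge 2$ an integer. For any $\mathcal{H}\in\mathcal{F}$ with VC-dimension $D$, we have $m_k(\mathcal{F})>(k-1)\left\lfloor\frac{D+1}{k}\right\rfloor$. In particular, $m_2(\mathcal{F})>\left\lceil\frac{D}{2}\right\rceil$.
   Context: A hypergraph $\mathcal{H}=(V,E)$ consists of a finite vertex set $V$ and a collection $E$ of subsets of $V$ (edges); it is $m$-heavy if all edges have size at least $m$. For $X\subset V$, the trace of $\mathcal{H}$ on $X$ is $(X,\{e\cap X:e\in E\})$. A family of hypergraphs is hereditary if it is closed under taking subhypergraphs (hypergraphs $(V',E')$ with $V'\subset V$, $E'\subset E$) and traces. The VC-dimension of $\mathcal{H}$ is the largest size of a set $X\subset V$ that is shattered, i.e., such that $\{e\cap X: e\in E\}$ contains every subset of $X$. A $k$-coloring of the vertices is polychromatic if every edge contains a vertex of each of the $k$ colors. $m_k(\mathcal{F})$ is the least $m$ such that every $m$-heavy hypergraph in $\mathcal{F}$ has a polychromatic $k$-coloring, and $m_k(\mathcal{F})=\infty$ if no such $m$ exists. -}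

module Defs where

open import Level using (Level; suc; _⊔_) renaming (zero to lzero)
open import Data.Nat using (ℕ; _≤_)
open import Data.Fin using (Fin)
open import Data.Fin.Subset using (Subset; _⊆_; _∩_; ∣_∣) renaming (_∈_ to _∈ₛ_)
open import Data.Vec using (tabulate; lookup)
open import Data.List using (List; map)
open import Data.List.Membership.Propositional using () renaming (_∈_ to _∈ₗ_)
open import Data.Product using (Σ; ∃; _×_; ∃-syntax)
open import Function using (_⇔_)
open import Function.Definitions using (Injective)
open import Relation.Binary.PropositionalEquality using (_≡_)
open import Relation.Nullary using (¬_)

-- A hypergraph on the vertex set Fin n; edges are subsets of Fin n
-- (a list, so the collection of edges is finite).
record Hypergraph : Set where
  constructor hg
  field
    n     : ℕ
    edges : List (Subset n)
open Hypergraph public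

Family : Set₁
Family = Hypergraph → Set

-- Preimage of a subset along a map (used to re-index the trace on the
-- image of an injection ι : Fin n' → Fin n, identified with a subset X ⊆ V).
preimage : ∀ {n n'} → (Fin n' → Fin n) → Subset n → Subset n'
preimage ι e = tabulate (λ u → lookup e (ι u))

trace : (H : Hypergraph) {n' : ℕ} → (Fin n' → Fin (n H)) → Hypergraph
trace H {n'} ι = hg n' (map (preimage ι) (edges H))

-- H' = (V', E') is a subhypergraph of H, with V' embedded in V via ι:
-- every edge of H' is (the copy of) an edge of H.
IsSubhypergraph : (H' H : Hypergraph) → (Fin (n H') → Fin (n H)) → Set
IsSubhypergraph H' H ι =
  Injective _≡_ _≡_ ι ×
  (∀ {e'} → e' ∈ₗ edges H' →
     ∃[ e ] (e ∈ₗ edges H ×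
       (∀ v → (v ∈ₛ e) ⇔ (∃[ u ] (ι u ≡ v × u ∈ₛ e')))))

Hereditary : Family → Set
Hereditary F =
  (∀ H H' (ι : Fin (n H') → Fin (n H)) → F H → IsSubhypergraph H' H ι → F H') ×
  (∀ H {n'} (ι : Fin n' → Fin (n H)) → Injective _≡_ _≡_ ι → F H → F (trace H ι))

Heavy : ℕ → Hypergraph → Set
Heavy m H = ∀ {e} → e ∈ₗ edges H → m ≤ ∣ e ∣

Shattered : (H : Hypergraph) → Subset (n H) → Set
Shattered H X = ∀ Y → Y ⊆ X → ∃[ e ] (e ∈ₗ edges H × e ∩ X ≡ Y)

VCdim : Hypergraph → ℕ → Set
VCdim H D =
  (∃[ X ] (Shattered H X × ∣ X ∣ ≡ D)) ×
  (∀ X → Shattered H X → ∣ X ∣ ≤ D)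

Polychromatic : (H : Hypergraph) (k : ℕ) → (Fin (n H) → Fin k) → Set
Polychromatic H k c =
  ∀ {e} → e ∈ₗ edges H → ∀ (i : Fin k) → ∃[ v ] (v ∈ₛ e × c v ≡ i)

-- m is admissible for m_k(F): every m-heavy hypergraph in F has a
-- polychromatic k-coloring.  m_k(F) is the least admissible m (∞ if none).
Admissible : Family → ℕ → ℕ → Set
Admissible F k m =
  ∀ H → F H → Heavy m H → ∃[ c ] Polychromatic H k c

-- m_k(F) > N  (including the case m_k(F) = ∞): no m ≤ N is admissible.
mk-> : Family → ℕ → ℕ → Set
mk-> F k N = ∀ m → m ≤ N → ¬ Admissible F k m

{-# OPTIONS --safe #-}
-- If X is shattered and ∣ X ∣ = N, the trace of H on X is the complete
-- hypergraph on N vertices, and keeping only its edges of size at least m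
-- stays in F.  In any k-colouring some colour class has a ≤ N / k vertices;
-- its complement is an edge of size N ∸ a ≥ (k ∸ 1) * ((N + 1) / k) ≥ m
-- missing that colour.
module Submission where

open import Defs
open import Data.Nat using (ℕ; zero; suc; _≤_; _+_; _*_; _∸_; _/_; ⌈_/2⌉; ⌊_/2⌋; NonZero; z≤n; s≤s; _≤?_)
open import Data.Nat.Properties
  using (≤-refl; ≤-reflexive; ≤-trans; ≤-total; ≤-<-connex; m<1+n⇒m≤n; m+n≤o⇒m≤o∸n;
         +-comm; *-comm; *-identityˡ; +-mono-≤; +-monoˡ-≤; +-monoʳ-≤; +-monoʳ-<; *-monoʳ-≤;
         +-0-commutativeMonoid; module ≤-Reasoning)
open import Data.Nat.DivMod using (m/n*n≤m; m/n≡1+[m∸n]/n)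
open import Data.Product using (_×_; _,_; ∃-syntax; proj₁; proj₂)
open import Data.Sum using (inj₁; inj₂)
open import Data.Bool using (true; false; if_then_else_; _∧_)
open import Data.Bool.Properties using (∧-identityʳ)
open import Data.Fin using (Fin; zero; suc)
open import Data.Fin.Properties using (_≟_; suc-injective)
open import Data.Fin.Subset using (Subset; _⊆_; _∩_; ∁; ∣_∣) renaming (_∈_ to _∈ₛ_)
open import Data.Fin.Subset.Properties using (⊆-refl; in⊆in; out⊆; x∈∁p⇒x∉p; ∣∁p∣≡n∸∣p∣)
open import Data.Vec using ([]; _∷_; tabulate; lookup; here; there)
open import Data.Vec.Properties using (tabulate-cong; lookup∘tabulate; lookup-zipWith; []=⇒lookup; lookup⇒[]=)
open import Data.List using (filter)
open import Data.List.Membership.Propositional using () renaming (_∈_ to _∈ₗ_)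
open import Data.List.Membership.Propositional.Properties using (∈-map⁺; ∈-filter⁺; ∈-filter⁻)
open import Algebra.Properties.CommutativeMonoid.Sum +-0-commutativeMonoid
  using (sum; sum-cong-≗; sum-replicate-zero; ∑-distrib-+)
open import Function using (_∘_; id; mk⇔)
open import Function.Definitions using (Injective)
open import Relation.Binary.PropositionalEquality
open import Relation.Nullary using (¬_; does)
open import Relation.Nullary.Decidable using (dec-true)

private
  variable
    d N : ℕ

enumerate : (X : Subset d) → Fin ∣ X ∣ → Fin d
enumerate (true ∷ X) zero = zero
enumerate (true ∷ X) (suc u) = suc (enumerate X u)
enumerate (false ∷ X) u = suc (enumerate X u)

enumerate-injective : (X : Subset d) → Injective _≡_ _≡_ (enumerate X)
enumerate-injective (true ∷ X) {zero} {zero} _ = refl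
enumerate-injective (true ∷ X) {suc u} {suc v} eq =
  cong suc (enumerate-injective X (suc-injective eq))
enumerate-injective (false ∷ X) eq = enumerate-injective X (suc-injective eq)

enumerate-∈ : (X : Subset d) (u : Fin ∣ X ∣) → enumerate X u ∈ₛ X
enumerate-∈ (true ∷ X) zero = here
enumerate-∈ (true ∷ X) (suc u) = there (enumerate-∈ X u)
enumerate-∈ (false ∷ X) u = there (enumerate-∈ X u)

embed : (X : Subset d) → Subset ∣ X ∣ → Subset d
embed [] Z = []
embed (true ∷ X) (b ∷ Z) = b ∷ embed X Z
embed (false ∷ X) Z = false ∷ embed X Z

embed-⊆ : (X : Subset d) (Z : Subset ∣ X ∣) → embed X Z ⊆ X
embed-⊆ [] Z = ⊆-refl
embed-⊆ (true ∷ X) (true ∷ Z) = in⊆in (embed-⊆ X Z)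
embed-⊆ (true ∷ X) (false ∷ Z) = out⊆ (embed-⊆ X Z)
embed-⊆ (false ∷ X) Z = out⊆ (embed-⊆ X Z)

preimage-enumerate-embed : (X : Subset d) (Z : Subset ∣ X ∣) →
                           preimage (enumerate X) (embed X Z) ≡ Z
preimage-enumerate-embed [] [] = refl
preimage-enumerate-embed (true ∷ X) (b ∷ Z) = cong (b ∷_) (preimage-enumerate-embed X Z)
preimage-enumerate-embed (false ∷ X) Z = preimage-enumerate-embed X Z

preimage-∩ : ∀ {d'} {X : Subset d} (ι : Fin d' → Fin d) → (∀ u → ι u ∈ₛ X) →
             ∀ e → preimage ι (e ∩ X) ≡ preimage ι e
preimage-∩ {X = X} ι ι∈X e = tabulate-cong λ u → begin
  lookup (e ∩ X) (ι u)            ≡⟨ lookup-zipWith _∧_ (ι u) e X ⟩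
  lookup e (ι u) ∧ lookup X (ι u) ≡⟨ cong (lookup e (ι u) ∧_) ([]=⇒lookup (ι∈X u)) ⟩
  lookup e (ι u) ∧ true           ≡⟨ ∧-identityʳ _ ⟩
  lookup e (ι u)                  ∎
  where open ≡-Reasoning

shattered⇒trace-complete : (H : Hypergraph) (X : Subset (n H)) → Shattered H X →
                           ∀ Z → Z ∈ₗ edges (trace H (enumerate X))
shattered⇒trace-complete H X shattered Z with shattered (embed X Z) (embed-⊆ X Z)
... | e , e∈H , e∩X≡embed = subst (_∈ₗ edges (trace H (enumerate X))) preimage≡Z
                                  (∈-map⁺ (preimage (enumerate X)) e∈H)
  where
  open ≡-Reasoning
  preimage≡Z : preimage (enumerate X) e ≡ Z
  preimage≡Z = begin
    preimage (enumerate X) e           ≡⟨ preimage-∩ (enumerate X) (enumerate-∈ X) e ⟨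
    preimage (enumerate X) (e ∩ X)     ≡⟨ cong (preimage (enumerate X)) e∩X≡embed ⟩
    preimage (enumerate X) (embed X Z) ≡⟨ preimage-enumerate-embed X Z ⟩
    Z                                  ∎

heavyPart : ℕ → Hypergraph → Hypergraph
heavyPart m H = hg (n H) (filter (λ e → m ≤? ∣ e ∣) (edges H))

heavyPart-heavy : ∀ m H → Heavy m (heavyPart m H)
heavyPart-heavy m H e∈ = proj₂ (∈-filter⁻ (λ e → m ≤? ∣ e ∣) {xs = edges H} e∈)

heavyPart-subhypergraph : ∀ m H → IsSubhypergraph (heavyPart m H) H id
heavyPart-subhypergraph m H = id , λ {e} e∈ →
  e , proj₁ (∈-filter⁻ (λ e → m ≤? ∣ e ∣) {xs = edges H} e∈) ,
  λ v → mk⇔ (λ v∈e → v , refl , v∈e) (λ { (_ , refl , v∈e) → v∈e })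

heavyPart-⊇ : ∀ {m H e} → e ∈ₗ edges H → m ≤ ∣ e ∣ → e ∈ₗ edges (heavyPart m H)
heavyPart-⊇ {m} e∈H m≤∣e∣ = ∈-filter⁺ (λ e → m ≤? ∣ e ∣) e∈H m≤∣e∣

∣∷∣ : ∀ b (p : Subset d) → ∣ b ∷ p ∣ ≡ (if b then 1 else 0) + ∣ p ∣
∣∷∣ true p = refl
∣∷∣ false p = refl

δ : ∀ {k} → Fin k → Fin k → ℕ
δ a i = if does (a ≟ i) then 1 else 0

∑-δ : ∀ {k} (a : Fin k) → sum (δ a) ≡ 1
∑-δ {suc k} zero = cong suc (sum-replicate-zero k)
∑-δ (suc a) = ∑-δ a

colourClass : ∀ {k} → (Fin N → Fin k) → Fin k → Subset N
colourClass c i = tabulate (λ u → does (c u ≟ i))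

∑∣colourClass∣ : ∀ {k} (c : Fin N → Fin k) → sum (∣_∣ ∘ colourClass c) ≡ N
∑∣colourClass∣ {zero} {k} c = sum-replicate-zero k
∑∣colourClass∣ {suc N} c = begin
  sum (∣_∣ ∘ colourClass c)
    ≡⟨ sum-cong-≗ (λ i → ∣∷∣ _ (colourClass (c ∘ suc) i)) ⟩
  sum (λ i → δ (c zero) i + ∣ colourClass (c ∘ suc) i ∣)
    ≡⟨ ∑-distrib-+ (δ (c zero)) (∣_∣ ∘ colourClass (c ∘ suc)) ⟩
  sum (δ (c zero)) + sum (∣_∣ ∘ colourClass (c ∘ suc))
    ≡⟨ cong₂ _+_ (∑-δ (c zero)) (∑∣colourClass∣ (c ∘ suc)) ⟩
  suc N ∎
  where open ≡-Reasoning

∃-≤-mean : ∀ j (f : Fin (suc j) → ℕ) → ∃[ i ] suc j * f i ≤ sum f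
∃-≤-mean zero f = zero , ≤-refl
∃-≤-mean (suc j) f with ∃-≤-mean j (f ∘ suc)
... | i , below-mean with ≤-total (f (suc i)) (f zero)
...   | inj₁ fᵢ≤f₀ = suc i , +-mono-≤ fᵢ≤f₀ below-mean
...   | inj₂ f₀≤fᵢ = zero , +-monoʳ-≤ (f zero) (≤-trans (*-monoʳ-≤ (suc j) f₀≤fᵢ) below-mean)

j*q+a≤N : ∀ j q {N a} → q * suc j ≤ suc N → suc j * a ≤ N → j * q + a ≤ N
j*q+a≤N j q {N} {a} q*k≤1+N k*a≤N with ≤-<-connex q a
... | inj₁ q≤a = begin
  j * q + a ≤⟨ +-monoˡ-≤ a (*-monoʳ-≤ j q≤a) ⟩
  j * a + a ≡⟨ +-comm (j * a) a ⟩
  suc j * a ≤⟨ k*a≤N ⟩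
  N         ∎
  where open ≤-Reasoning
... | inj₂ a<q = m<1+n⇒m≤n (begin-strict
  j * q + a <⟨ +-monoʳ-< (j * q) a<q ⟩
  j * q + q ≡⟨ +-comm (j * q) q ⟩
  suc j * q ≡⟨ *-comm (suc j) q ⟩
  q * suc j ≤⟨ q*k≤1+N ⟩
  suc N     ∎)
  where open ≤-Reasoning

colourClass-∁ : ∀ {k} (c : Fin N → Fin k) {i v} → v ∈ₛ ∁ (colourClass c i) → c v ≢ i
colourClass-∁ c {i} {v} v∈∁ cv≡i = x∈∁p⇒x∉p v∈∁ (lookup⇒[]= v (colourClass c i) (begin
  lookup (colourClass c i) v ≡⟨ lookup∘tabulate _ v ⟩
  does (c v ≟ i)             ≡⟨ dec-true (c v ≟ i) cv≡i ⟩
  true                       ∎))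
  where open ≡-Reasoning

∃-large-colourClass-∁ : ∀ j {m} (c : Fin N → Fin (suc j)) → m ≤ j * ((N + 1) / suc j) →
                         ∃[ i ] m ≤ ∣ ∁ (colourClass c i) ∣
∃-large-colourClass-∁ {N} j {m} c m≤bound with ∃-≤-mean j (∣_∣ ∘ colourClass c)
... | i , below-mean = i , (begin
  m                          ≤⟨ m+n≤o⇒m≤o∸n m (≤-trans (+-monoˡ-≤ a m≤bound) bound+a≤N) ⟩
  N ∸ a                      ≡⟨ ∣∁p∣≡n∸∣p∣ (colourClass c i) ⟨
  ∣ ∁ (colourClass c i) ∣    ∎)
  where
  open ≤-Reasoning
  a = ∣ colourClass c i ∣
  bound+a≤N : j * ((N + 1) / suc j) + a ≤ N
  bound+a≤N = j*q+a≤N j ((N + 1) / suc j)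
    (≤-trans (m/n*n≤m (N + 1) (suc j)) (≤-reflexive (+-comm N 1)))
    (≤-trans below-mean (≤-reflexive (∑∣colourClass∣ c)))

complete-¬polychromatic : ∀ j {m} (G : Hypergraph) → (∀ Z → m ≤ ∣ Z ∣ → Z ∈ₗ edges G) →
                          m ≤ j * ((n G + 1) / suc j) → ¬ (∃[ c ] Polychromatic G (suc j) c)
complete-¬polychromatic j G complete m≤bound (c , polychromatic)
  with ∃-large-colourClass-∁ j c m≤bound
... | i , m≤∣Z∣ with polychromatic (complete (∁ (colourClass c i)) m≤∣Z∣) i
...   | v , v∈Z , cv≡i = colourClass-∁ c v∈Z cv≡i

shattered⇒mk-> : (F : Family) → Hereditary F → (j : ℕ) (H : Hypergraph) → F H →
                 (X : Subset (n H)) → Shattered H X → mk-> F (suc j) (j * ((∣ X ∣ + 1) / suc j))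
shattered⇒mk-> F (subhypergraph-closed , trace-closed) j H FH X shattered m m≤bound admissible =
  complete-¬polychromatic j G complete m≤bound (admissible G FG (heavyPart-heavy m T))
  where
  T = trace H (enumerate X)
  G = heavyPart m T
  FG : F G
  FG = subhypergraph-closed T G id
         (trace-closed H (enumerate X) (enumerate-injective X) FH) (heavyPart-subhypergraph m T)
  complete : ∀ Z → m ≤ ∣ Z ∣ → Z ∈ₗ edges G
  complete Z = heavyPart-⊇ (shattered⇒trace-complete H X shattered Z)

mk->-≤ : ∀ {F k N M} → mk-> F k N → M ≤ N → mk-> F k M
mk->-≤ N-bound M≤N m m≤M = N-bound m (≤-trans m≤M M≤N)

⌊n/2⌋≡n/2 : ∀ n → ⌊ n /2⌋ ≡ n / 2
⌊n/2⌋≡n/2 zero = refl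
⌊n/2⌋≡n/2 (suc zero) = refl
⌊n/2⌋≡n/2 (suc (suc n)) = trans (cong suc (⌊n/2⌋≡n/2 n)) 
  (sym (m/n≡1+[m∸n]/n {2 + n} (s≤s (s≤s z≤n))))

corollary6 : (F : Family) → Hereditary F →
    (k : ℕ) .{{_ : NonZero k}} → 2 ≤ k →
    (H : Hypergraph) → F H → (D : ℕ) → VCdim H D →
      mk-> F k ((k ∸ 1) * ((D + 1) / k)) × mk-> F 2 ⌈ D /2⌉
corollary6 F hereditary (suc j) _ H FH D ((X , shattered , refl) , _) =
  shattered⇒mk-> F hereditary j H FH X shattered ,
  mk->-≤ (shattered⇒mk-> F hereditary 1 H FH X shattered) (≤-reflexive (begin
    ⌈ D /2⌉           ≡⟨ ⌊n/2⌋≡n/2 (suc D) ⟩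
    suc D / 2         ≡⟨ cong (_/ 2) (+-comm 1 D) ⟩
    (D + 1) / 2       ≡⟨ *-identityˡ _ ⟨
    1 * ((D + 1) / 2) ∎))
  where open ≡-Reasoning
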